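{- Let $\omega$ and $n$ be positive integers with $n>3\omega-3$. There is no set of $n$ pairwise disjoint chords contained in $\mathcal{D}_{n,\omega}$.
   Context: For positive integers $\omega$ and $n$ with $n>3\omega-3$, the chord diagram $\mathcal D_{n,\omega}$ is defined as follows. Let $p_1, q_1, p_2, q_2, \dots , p_n , q_n$ be points on a circle in cyclic clockwise order. For each $i\in \{1,\dots,n\}$ and $j\in \{1,\dots,\omega-1\}$, let $\mathcal{C}_{i,j}$ consist of exactly $\lfloor \omega/(j+1) \rfloor$ coinciding open chords with endpoints $p_i$ and $q_{i+j}$ (indices taken modulo $n$). Then $\mathcal{D}_{n,\omega}$ is the collection $\bigcup_{i}\bigcup_{j} \mathcal{C}_{i,j}$, with coinciding chords counted as distinct elements. Chords are open segments, and two chords intersect iff these open segments intersect; in particular two coinciding chords intersect, while two chords sharing exactly one endpoint are disjoint. -}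

module Defs where

open import Data.Nat using (ℕ; zero; suc; _+_; _*_; _∸_; _≤_; _<_; NonZero)
open import Data.Nat.DivMod using (_/_; _%_)
open import Data.Fin using (Fin; toℕ)
open import Data.Product using (_×_)
open import Data.Sum using (_⊎_)
open import Relation.Nullary using (¬_)
open import Relation.Binary.PropositionalEquality using (_≡_; _≢_)

-- Points on the circle: p_0, q_0, p_1, q_1, ..., p_{n-1}, q_{n-1} in clockwise
-- order, encoded by positions 0 .. 2n-1:  p_i ↦ 2i,  q_i ↦ 2i+1.
-- (The paper indexes 1..n; we index 0..n-1, which is the same up to relabelling.)

-- z lies strictly inside the clockwise arc going from x to y
-- (positions are in [0, 2n), clockwise = increasing position, wrapping around).
StrictlyBetween : ℕ → ℕ → ℕ → Set
StrictlyBetween x y z = (x < y × (x < z × z < y)) ⊎ (y < x × (x < z ⊎ z < y))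

-- Two open chords with endpoints {a,b} and {c,d} (a ≢ b, c ≢ d) intersect iff
-- they coincide, or their four endpoints are distinct and interleave.
ChordsIntersect : ℕ → ℕ → ℕ → ℕ → Set
ChordsIntersect a b c d =
  ((a ≡ c × b ≡ d) ⊎ (a ≡ d × b ≡ c))
  ⊎ ((a ≢ c × a ≢ d × b ≢ c × b ≢ d)
     × ((StrictlyBetween a b c × ¬ StrictlyBetween a b d)
        ⊎ (¬ StrictlyBetween a b c × StrictlyBetween a b d)))

-- An element of D_{n,ω}: the chord from p_i to q_{i+j} (j ∈ {1,…,ω-1}),
-- together with a copy index k < ⌊ω/(j+1)⌋ distinguishing coinciding chords.
record Chord (n ω : ℕ) : Set where
  constructor chord
  field
    i    : Fin n
    j    : ℕ
    k    : ℕ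
    1≤j  : 1 ≤ j
    j<ω  : j < ω
    k<   : k < ω / suc j

open Chord public

startPos : ∀ {n ω} → Chord n ω → ℕ
startPos c = 2 * toℕ (i c)

endPos : ∀ {n ω} .{{_ : NonZero n}} → Chord n ω → ℕ
endPos {n} c = 2 * ((toℕ (i c) + j c) % n) + 1

Intersect : ∀ {n ω} .{{_ : NonZero n}} → Chord n ω → Chord n ω → Set
Intersect c d = ChordsIntersect (startPos c) (endPos c) (startPos d) (endPos d)

Disjoint : ∀ {n ω} .{{_ : NonZero n}} → Chord n ω → Chord n ω → Set
Disjoint c d = ¬ Intersect c d

-- A set of m pairwise disjoint chords contained in D_{n,ω}: an injective
-- family of m elements of D_{n,ω} (coinciding chords are distinct elements),
-- any two distinct members of which are disjoint.
PairwiseDisjointFamily : ∀ {n ω} .{{_ : NonZero n}} (m : ℕ) → (Fin m → Chord n ω) → Set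
PairwiseDisjointFamily m f =
  (∀ x y → f x ≡ f y → x ≡ y) × (∀ x y → x ≢ y → Disjoint (f x) (f y))

-- Let x₀ be a longest chord, of length j₀, and cut the circle at its start p_{i₀}. Any two
-- lengths satisfy j + j′ ≤ 2ω − 2 < n, so a chord passing over p_{i₀} would interleave with x₀.
-- Hence, read clockwise from p_{i₀}, every chord p_s q_{s+j} of a disjoint family becomes an
-- interval [s, s + j] inside [i₀, i₀ + n − 1], and disjoint chords give distinct intervals that
-- are nested or separated. Such a laminar family of intervals on m + 1 points has at most m
-- members, which leaves room for only n − 1 chords. Neither the copy indices nor the
-- injectivity of the family matter: coinciding chords intersect.
module Submission where

open import Defs
open import Data.Bool using (true; false)
open import Data.Empty using (⊥; ⊥-elim)
open import Data.Fin using (Fin; toℕ; zero) renaming (_≟_ to _≟ᶠ_)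
open import Data.Fin.Properties using (toℕ<n)
open import Data.List using (List; []; _∷_; length; filter; tabulate; allFin)
open import Data.List.Extrema.Nat using (argmin; argmin-all; f[argmin]≤f[xs]; argmax; f[xs]≤f[argmax])
open import Data.List.Membership.Propositional using (_∈_; _∉_; find; lose)
open import Data.List.Membership.Propositional.Properties using (∈-filter⁺; ∈-filter⁻; ∈-tabulate⁻; ∈-allFin)
open import Data.List.Properties using (filter-all; length-tabulate)
open import Data.List.Relation.Unary.All as All using ()
open import Data.List.Relation.Unary.Any using (Any; here; any?)
open import Data.List.Relation.Unary.Unique.Propositional using (Unique; _∷_)
open import Data.List.Relation.Unary.Unique.Propositional.Properties as Unique using ()
open import Data.Nat
open import Data.Nat.DivMod
open import Data.Nat.Properties
open import Data.Nat.Tactic.RingSolver using (solve-∀)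
open import Data.Product using (∃; _×_; _,_; proj₁; proj₂)
open import Data.Product.Properties using (≡-dec)
open import Data.Sum using (inj₁; inj₂)
open import Level using (0ℓ)
open import Relation.Binary.PropositionalEquality
open import Relation.Nullary using (¬_; Dec; yes; no; ¬?; does)
open import Relation.Unary using (Pred; Decidable)
open import Relation.Unary.Properties using (∁?)

-- Laminar families of intervals

Interval : Set
Interval = ℕ × ℕ

_≟ᵢ_ : (I J : Interval) → Dec (I ≡ J)
_≟ᵢ_ = ≡-dec _≟_ _≟_

Within : ℕ → ℕ → Interval → Set
Within L R (a , b) = L ≤ a × a < b × b ≤ R

-- Intervals are closed, so [a, b] and [b, c] cross.
Crosses : Interval → Interval → Set
Crosses (a , b) (c , d) = a < c × c ≤ b × b < d

record LaminarIn (L R : ℕ) (xs : List Interval) : Set where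
  field
    unique      : Unique xs
    within      : ∀ {I} → I ∈ xs → Within L R I
    noncrossing : ∀ {I J} → I ∈ xs → J ∈ xs → ¬ Crosses I J

open LaminarIn

rebound-laminar : ∀ {L R L′ R′ xs} → LaminarIn L R xs → (∀ {I} → I ∈ xs → Within L′ R′ I) →
                  LaminarIn L′ R′ xs
rebound-laminar lam within′ = record { LaminarIn lam ; within = within′ }

module _ {P : Pred Interval 0ℓ} (P? : Decidable P) where

  filter-laminar : ∀ {L R L′ R′ xs} → LaminarIn L R xs → (∀ {I} → I ∈ xs → P I → Within L′ R′ I) →
                   LaminarIn L′ R′ (filter P? xs)
  filter-laminar lam within′ = record
    { unique      = Unique.filter⁺ P? (unique lam)
    ; within      = λ I∈ → let I∈xs , pI = ∈-filter⁻ P? I∈ in within′ I∈xs pI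
    ; noncrossing = λ I∈ J∈ → noncrossing lam (proj₁ (∈-filter⁻ P? I∈)) (proj₁ (∈-filter⁻ P? J∈))
    }

  length-filter+length-filter-∁ : ∀ xs → length (filter P? xs) + length (filter (∁? P?) xs) ≡ length xs
  length-filter+length-filter-∁ [] = refl
  length-filter+length-filter-∁ (x ∷ xs) with does (P? x)
  ... | true  = cong suc (length-filter+length-filter-∁ xs)
  ... | false = trans (+-suc _ _) (cong suc (length-filter+length-filter-∁ xs))

_≢?_ : (I t : Interval) → Dec (I ≢ t)
I ≢? t = ¬? (I ≟ᵢ t)

without : Interval → List Interval → List Interval
without t = filter (_≢? t)

length≤1+length-without : ∀ t {xs} → Unique xs → length xs ≤ suc (length (without t xs))
length≤1+length-without t {[]} _ = z≤n
length≤1+length-without t {x ∷ xs} (x∉xs ∷ u) with x ≟ᵢ t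
... | yes refl = s≤s (≤-reflexive (cong length (sym (filter-all (_≢? t) (All.map ≢-sym x∉xs)))))
... | no _     = s≤s (length≤1+length-without t u)

least-start-ending-at : ∀ {R xs} → Any (λ I → proj₂ I ≡ R) xs →
                        ∃ λ a → (a , R) ∈ xs × (∀ {s} → (s , R) ∈ xs → a ≤ s)
least-start-ending-at {R} {xs} ends-at-R with find ends-at-R
... | I₀ , I₀∈xs , I₀-ends =
  proj₁ I , subst (λ b → (proj₁ I , b) ∈ xs) (proj₂ I∈xs×I-ends) (proj₁ I∈xs×I-ends) , least
  where
  ends? : (I : Interval) → Dec (proj₂ I ≡ R)
  ends? I = proj₂ I ≟ R
  ending : List Interval
  ending = filter ends? xs
  I : Interval
  I = argmin proj₁ I₀ ending
  I∈xs×I-ends : I ∈ xs × proj₂ I ≡ R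
  I∈xs×I-ends = argmin-all proj₁ (I₀∈xs , I₀-ends) (All.tabulate (∈-filter⁻ ends?))
  least : ∀ {s} → (s , R) ∈ xs → proj₁ I ≤ s
  least sR∈xs = All.lookup (f[argmin]≤f[xs] I₀ ending) (∈-filter⁺ ends? sR∈xs refl)

-- Once the interval (L, R) is removed, let (a, R) be the
-- member ending at R with the least start: members starting before a cannot reach a without
-- crossing (a, R), so the family splits into one inside [L, a − 1] and one inside [a, R].
private
  laminar-bound : ∀ d {L R xs} → R ≤ d + L → L ≤ R → LaminarIn L R xs → length xs + L ≤ R
  laminar-bound-untopped : ∀ d {L R xs} → R ≤ d + L → L < R → (L , R) ∉ xs → LaminarIn L R xs →
                           suc (length xs) + L ≤ R
  laminar-bound-split : ∀ d {L a R xs} → R ≤ suc d + L → L < a → (a , R) ∈ xs →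
                        (∀ {s} → (s , R) ∈ xs → a ≤ s) → LaminarIn L R xs → suc (length xs) + L ≤ R

  laminar-bound d {xs = []} _ L≤R _ = L≤R
  laminar-bound d {L} {R} {xs@(I ∷ _)} R≤d+L _ lam =
    ≤-trans (+-monoˡ-≤ L (length≤1+length-without (L , R) (unique lam)))
            (laminar-bound-untopped d R≤d+L L<R top∉
              (filter-laminar (_≢? (L , R)) lam (λ J∈ _ → within lam J∈)))
    where
    L<R : L < R
    L<R = let L≤a , a<b , b≤R = within lam {I} (here refl) in <-≤-trans (≤-<-trans L≤a a<b) b≤R
    top∉ : (L , R) ∉ without (L , R) xs
    top∉ top∈ = proj₂ (∈-filter⁻ (_≢? (L , R)) {xs = xs} top∈) refl

  laminar-bound-untopped zero R≤L L<R _ _ = ⊥-elim (<⇒≱ L<R R≤L)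
  laminar-bound-untopped (suc d) {L} {suc R} {xs} R≤ (s≤s L≤R) top∉ lam
    with any? (λ I → proj₂ I ≟ suc R) xs
  ... | yes ends-at-top with least-start-ending-at ends-at-top
  ...   | a , aR∈xs , least =
          laminar-bound-split d R≤ L<a aR∈xs least lam
    where
    L<a : L < a
    L<a = ≤∧≢⇒< (proj₁ (within lam aR∈xs)) λ { refl → top∉ aR∈xs }
  laminar-bound-untopped (suc d) {L} {suc R} {xs} R≤ (s≤s L≤R) top∉ lam
      | no none-at-top = s≤s (laminar-bound d (≤-pred R≤) L≤R (rebound-laminar lam below-top))
    where
    below-top : ∀ {I} → I ∈ xs → Within L R I
    below-top I∈ = let L≤a , a<b , b≤1+R = within lam I∈ in
      L≤a , a<b , m<1+n⇒m≤n (≤∧≢⇒< b≤1+R λ b≡1+R → none-at-top (lose I∈ b≡1+R))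

  laminar-bound-split d {L} {suc m} {R} {xs} R≤ (s≤s L≤m) top∈ least lam = begin
    suc (length xs) + L                  ≡⟨ cong (λ k → suc k + L) (length-filter+length-filter-∁ left? xs) ⟨
    suc (length left + length right) + L ≡⟨ rearrange (length left) (length right) L ⟩
    length right + suc (length left + L) ≤⟨ +-monoʳ-≤ (length right) (s≤s left-bound) ⟩
    length right + suc m                 ≤⟨ right-bound ⟩
    R                                    ∎
    where
    open ≤-Reasoning
    left? : (I : Interval) → Dec (proj₁ I < suc m)
    left? I = proj₁ I <? suc m
    left right : List Interval
    left = filter left? xs
    right = filter (∁? left?) xs
    rearrange : ∀ l r L → suc (l + r) + L ≡ r + suc (l + L)
    rearrange = solve-∀
    left-within : ∀ {I} → I ∈ xs → proj₁ I < suc m → Within L m I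
    left-within {s , e} I∈ s≤m with within lam I∈
    ... | L≤s , s<e , e≤R with e <? suc m
    ...   | yes e≤m = L≤s , s<e , m<1+n⇒m≤n e≤m
    ...   | no e≰m with m≤n⇒m<n∨m≡n e≤R
    ...     | inj₁ e<R = ⊥-elim (noncrossing lam I∈ top∈ (s≤m , ≮⇒≥ e≰m , e<R))
    ...     | inj₂ refl = ⊥-elim (<⇒≱ s≤m (least I∈))
    right-within : ∀ {I} → I ∈ xs → ¬ (proj₁ I < suc m) → Within (suc m) R I
    right-within I∈ s≮1+m = let _ , s<e , e≤R = within lam I∈ in ≮⇒≥ s≮1+m , s<e , e≤R
    1+m<R : suc m < R
    1+m<R = proj₁ (proj₂ (within lam top∈))
    left-bound : length left + L ≤ m
    left-bound = laminar-bound d (≤-pred (≤-trans (<⇒≤ 1+m<R) R≤)) L≤m (filter-laminar left? lam left-within)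
    right-bound : length right + suc m ≤ R
    right-bound = laminar-bound d R≤d+1+m (<⇒≤ 1+m<R) (filter-laminar (∁? left?) lam right-within)
      where
      R≤d+1+m : R ≤ d + suc m
      R≤d+1+m = ≤-trans R≤ (subst (suc (d + L) ≤_) (sym (+-suc d m)) (s≤s (+-monoʳ-≤ d L≤m)))

laminar-length : ∀ {L R xs} → L ≤ R → LaminarIn L R xs → length xs + L ≤ R
laminar-length {L} {R} = laminar-bound R (m≤m+n R L)

[m+k]%n≡[m%n+k]%n : ∀ m k n .{{_ : NonZero n}} → (m + k) % n ≡ (m % n + k) % n
[m+k]%n≡[m%n+k]%n m k n = begin
  (m + k) % n             ≡⟨ %-distribˡ-+ m k n ⟩
  (m % n + k % n) % n     ≡⟨ cong (λ x → (x + k % n) % n) (m%n%n≡m%n m n) ⟨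
  (m % n % n + k % n) % n ≡⟨ %-distribˡ-+ (m % n) k n ⟨
  (m % n + k) % n         ∎
  where open ≡-Reasoning

-- Cyclic order of residues

data Clockwise (x y z : ℕ) : Set where
  x<y<z : x < y → y < z → Clockwise x y z
  y<z<x : y < z → z < x → Clockwise x y z
  z<x<y : z < x → x < y → Clockwise x y z

Clockwise-rotate : ∀ {x y z} → Clockwise x y z → Clockwise y z x
Clockwise-rotate (x<y<z x<y y<z) = z<x<y x<y y<z
Clockwise-rotate (y<z<x y<z z<x) = x<y<z y<z z<x
Clockwise-rotate (z<x<y z<x x<y) = y<z<x z<x x<y

Clockwise⇒≢ : ∀ {x y z} → Clockwise x y z → x ≢ y
Clockwise⇒≢ (x<y<z x<y _)   = <⇒≢ x<y
Clockwise⇒≢ (y<z<x y<z z<x) = >⇒≢ (<-trans y<z z<x)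
Clockwise⇒≢ (z<x<y _ x<y)   = <⇒≢ x<y

Clockwise⇒StrictlyBetween : ∀ {x y z} → Clockwise x y z → StrictlyBetween x z y
Clockwise⇒StrictlyBetween (x<y<z x<y y<z) = inj₁ (<-trans x<y y<z , x<y , y<z)
Clockwise⇒StrictlyBetween (y<z<x y<z z<x) = inj₂ (z<x , inj₂ y<z)
Clockwise⇒StrictlyBetween (z<x<y z<x x<y) = inj₂ (z<x , inj₁ x<y)

Clockwise⇒¬StrictlyBetween : ∀ {x y z} → Clockwise x y z → ¬ StrictlyBetween x y z
Clockwise⇒¬StrictlyBetween (x<y<z x<y y<z) (inj₁ (_ , _ , z<y))       = <-asym y<z z<y
Clockwise⇒¬StrictlyBetween (x<y<z x<y y<z) (inj₂ (y<x , _))           = <-asym x<y y<x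
Clockwise⇒¬StrictlyBetween (y<z<x y<z z<x) (inj₁ (x<y , _))           = <-asym (<-trans y<z z<x) x<y
Clockwise⇒¬StrictlyBetween (y<z<x y<z z<x) (inj₂ (_ , inj₁ x<z))      = <-asym z<x x<z
Clockwise⇒¬StrictlyBetween (y<z<x y<z z<x) (inj₂ (_ , inj₂ z<y))      = <-asym y<z z<y
Clockwise⇒¬StrictlyBetween (z<x<y z<x x<y) (inj₁ (_ , x<z , _))       = <-asym z<x x<z
Clockwise⇒¬StrictlyBetween (z<x<y z<x x<y) (inj₂ (y<x , _))           = <-asym x<y y<x

module _ {N : ℕ} .{{_ : NonZero N}} where

  private
    %-wrap : ∀ {x} → N ≤ x → x < N + N → x % N ≡ x ∸ N
    %-wrap {x} N≤x x<2N = trans (sym (m≤n⇒[n∸m]%m≡n%m N≤x)) (m<n⇒m%n≡m (m<n+o⇒m∸n<o x N x<2N))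

    r+e∸N<r : ∀ {r e} → e < N → N ≤ r + e → r + e ∸ N < r
    r+e∸N<r {r} {e} e<N N≤r+e = subst (r + e ∸ N <_) (m+n∸n≡m r N) (∸-monoˡ-< (+-monoʳ-< r e<N) N≤r+e)

  Clockwise-offsets : ∀ {r d e} → r < N → 0 < d → d < e → e < N →
                      Clockwise r ((r + d) % N) ((r + e) % N)
  Clockwise-offsets {r} {d} {e} r<N 0<d d<e e<N with r + d <? N | r + e <? N
  ... | yes r+d<N | yes r+e<N rewrite m<n⇒m%n≡m r+d<N | m<n⇒m%n≡m r+e<N =
    x<y<z (m<m+n r 0<d) (+-monoʳ-< r d<e)
  ... | yes r+d<N | no r+e≮N rewrite m<n⇒m%n≡m r+d<N | %-wrap (≮⇒≥ r+e≮N) (+-mono-< r<N e<N) =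
    z<x<y (r+e∸N<r e<N (≮⇒≥ r+e≮N)) (m<m+n r 0<d)
  ... | no r+d≮N | yes r+e<N = ⊥-elim (r+d≮N (<-trans (+-monoʳ-< r d<e) r+e<N))
  ... | no r+d≮N | no r+e≮N
    rewrite %-wrap (≮⇒≥ r+d≮N) (+-mono-< r<N (<-trans d<e e<N)) | %-wrap (≮⇒≥ r+e≮N) (+-mono-< r<N e<N) =
    y<z<x (∸-monoˡ-< (+-monoʳ-< r d<e) (≮⇒≥ r+d≮N)) (r+e∸N<r e<N (≮⇒≥ r+e≮N))

  Clockwise-mod : ∀ {u v w} → u < v → v < w → w < u + N → Clockwise (u % N) (v % N) (w % N)
  Clockwise-mod {u} {v} {w} u<v v<w w<u+N =
    subst₂ (Clockwise (u % N)) (offset (<⇒≤ u<v)) (offset (<⇒≤ (<-trans u<v v<w)))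
      (Clockwise-offsets (m%n<n u N) (m<n⇒0<n∸m u<v) (∸-monoˡ-< v<w (<⇒≤ u<v)) (m<n+o⇒m∸n<o w u w<u+N))
    where
    offset : ∀ {x} → u ≤ x → (u % N + (x ∸ u)) % N ≡ x % N
    offset u≤x = trans (sym ([m+k]%n≡[m%n+k]%n u _ N)) (cong (_% N) (m+[n∸m]≡n u≤x))

  interleaved⇒ChordsIntersect : ∀ {u₁ u₂ u₃ u₄} → u₁ < u₂ → u₂ < u₃ → u₃ < u₄ → u₄ < u₁ + N →
                                ChordsIntersect (u₁ % N) (u₃ % N) (u₂ % N) (u₄ % N)
  interleaved⇒ChordsIntersect {u₁} {u₂} {u₃} {u₄} u₁<u₂ u₂<u₃ u₃<u₄ u₄<u₁+N =
    inj₂ ( ( Clockwise⇒≢ a→c→b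
           , ≢-sym (Clockwise⇒≢ (Clockwise-rotate (Clockwise-rotate a→b→d)))
           , ≢-sym (Clockwise⇒≢ (Clockwise-rotate a→c→b))
           , Clockwise⇒≢ (Clockwise-rotate a→b→d) )
         , inj₁ (Clockwise⇒StrictlyBetween a→c→b , Clockwise⇒¬StrictlyBetween a→b→d) )
    where
    a→c→b : Clockwise (u₁ % N) (u₂ % N) (u₃ % N)
    a→c→b = Clockwise-mod u₁<u₂ u₂<u₃ (<-trans u₃<u₄ u₄<u₁+N)
    a→b→d : Clockwise (u₁ % N) (u₃ % N) (u₄ % N)
    a→b→d = Clockwise-mod (<-trans u₁<u₂ u₂<u₃) u₃<u₄ u₄<u₁+N

-- Chords lifted from the circle of 2n positions to ℕ

2*m+1<2*n : ∀ {m n} → m < n → 2 * m + 1 < 2 * n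
2*m+1<2*n {m} {n} m<n = ≤-trans (≤-reflexive (step m)) (*-monoʳ-≤ 2 m<n)
  where
  step : ∀ m → suc (2 * m + 1) ≡ 2 * suc m
  step = solve-∀

module _ {n : ℕ} .{{_ : NonZero n}} where

  private instance
    2*n≢0 : NonZero (2 * n)
    2*n≢0 = m*n≢0 2 n

  [2*m+r]%[2*n]≡2*[m%n]+r : ∀ m r → r < 2 → (2 * m + r) % (2 * n) ≡ 2 * (m % n) + r
  [2*m+r]%[2*n]≡2*[m%n]+r m r r<2 = begin
    (2 * m + r) % (2 * n)                         ≡⟨ cong (λ x → (2 * x + r) % (2 * n)) (m≡m%n+[m/n]*n m n) ⟩
    (2 * (m % n + m / n * n) + r) % (2 * n)       ≡⟨ cong (_% (2 * n)) (regroup (m % n) (m / n) n r) ⟩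
    (2 * (m % n) + r + m / n * (2 * n)) % (2 * n) ≡⟨ [m+kn]%n≡m%n (2 * (m % n) + r) (m / n) (2 * n) ⟩
    (2 * (m % n) + r) % (2 * n)                   ≡⟨ m<n⇒m%n≡m below ⟩
    2 * (m % n) + r                               ∎
    where
    open ≡-Reasoning
    regroup : ∀ a q k r → 2 * (a + q * k) + r ≡ 2 * a + r + q * (2 * k)
    regroup = solve-∀
    below : 2 * (m % n) + r < 2 * n
    below = ≤-<-trans (+-monoʳ-≤ (2 * (m % n)) (≤-pred r<2)) (2*m+1<2*n (m%n<n m n))

  [2*m]%[2*n]≡2*[m%n] : ∀ m → (2 * m) % (2 * n) ≡ 2 * (m % n)
  [2*m]%[2*n]≡2*[m%n] m =
    subst₂ (λ a b → a % (2 * n) ≡ b) (+-identityʳ (2 * m)) (+-identityʳ (2 * (m % n)))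
      ([2*m+r]%[2*n]≡2*[m%n]+r m 0 z<s)

  startPos-lift : ∀ {ω} {c : Chord n ω} {s} → s % n ≡ toℕ (i c) → startPos c ≡ (2 * s) % (2 * n)
  startPos-lift {_} {c} {s} s%n≡i = begin
    2 * toℕ (i c)     ≡⟨ cong (2 *_) s%n≡i ⟨
    2 * (s % n)       ≡⟨ [2*m]%[2*n]≡2*[m%n] s ⟨
    (2 * s) % (2 * n) ∎
    where open ≡-Reasoning

  endPos-lift : ∀ {ω} {c : Chord n ω} {s} → s % n ≡ toℕ (i c) → endPos c ≡ (2 * (s + j c) + 1) % (2 * n)
  endPos-lift {_} {c} {s} s%n≡i = begin
    2 * ((toℕ (i c) + j c) % n) + 1 ≡⟨ cong (λ x → 2 * ((x + j c) % n) + 1) s%n≡i ⟨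
    2 * ((s % n + j c) % n) + 1     ≡⟨ cong (λ x → 2 * x + 1) ([m+k]%n≡[m%n+k]%n s (j c) n) ⟨
    2 * ((s + j c) % n) + 1         ≡⟨ [2*m+r]%[2*n]≡2*[m%n]+r (s + j c) 1 (s≤s z<s) ⟨
    (2 * (s + j c) + 1) % (2 * n)   ∎
    where open ≡-Reasoning

  coincident⇒Intersect : ∀ {ω} {c d : Chord n ω} → toℕ (i c) ≡ toℕ (i d) → j c ≡ j d → Intersect c d
  coincident⇒Intersect i≡ j≡ =
    inj₁ (inj₁ (cong (2 *_) i≡ , cong (λ m → 2 * (m % n) + 1) (cong₂ _+_ i≡ j≡)))

  interleaved⇒Intersect : ∀ {ω} {c d : Chord n ω} {s t} → s % n ≡ toℕ (i c) → t % n ≡ toℕ (i d) →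
                          s < t → t ≤ s + j c → s + j c < t + j d → t + j d < s + n → Intersect c d
  interleaved⇒Intersect {_} {c} {d} {s} {t} s≡ t≡ s<t t≤e e<e′ e′<s+n =
    subst₂ (λ a b → ChordsIntersect a b (startPos d) (endPos d))
      (sym (startPos-lift {c = c} s≡)) (sym (endPos-lift {c = c} s≡))
      (subst₂ (ChordsIntersect _ _) (sym (startPos-lift {c = d} t≡)) (sym (endPos-lift {c = d} t≡))
        (interleaved⇒ChordsIntersect
          (*-monoʳ-< 2 s<t)
          (≤-<-trans (*-monoʳ-≤ 2 t≤e) (m<m+n _ z<s))
          (+-monoˡ-< 1 (*-monoʳ-< 2 e<e′))
          (subst (2 * (t + j d) + 1 <_) (*-distribˡ-+ 2 s n) (2*m+1<2*n e′<s+n))))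

-- A disjoint family of n chords

liftAbove : ℕ → ℕ → ℕ → ℕ
liftAbove n b r with b ≤? r
... | yes _ = r
... | no _  = r + n

module _ {n b r : ℕ} where

  b≤liftAbove : b < n → b ≤ liftAbove n b r
  b≤liftAbove b<n with b ≤? r
  ... | yes b≤r = b≤r
  ... | no _    = ≤-trans (<⇒≤ b<n) (m≤n+m n r)

  liftAbove<b+n : r < n → liftAbove n b r < b + n
  liftAbove<b+n r<n with b ≤? r
  ... | yes _   = <-≤-trans r<n (m≤n+m n b)
  ... | no b≰r  = +-monoˡ-< n (≰⇒> b≰r)

  liftAbove-% : .{{_ : NonZero n}} → r < n → liftAbove n b r % n ≡ r
  liftAbove-% r<n with b ≤? r
  ... | yes _ = m<n⇒m%n≡m r<n
  ... | no _  = trans ([m+n]%n≡m%n r n) (m<n⇒m%n≡m r<n)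

liftAbove-self : ∀ n b → liftAbove n b b ≡ b
liftAbove-self n b with b ≤? b
... | yes _  = refl
... | no b≰b = ⊥-elim (b≰b ≤-refl)

m<o⇒n<o⇒m+n≤3*o∸3 : ∀ {m n o} → m < o → n < o → m + n ≤ 3 * o ∸ 3
m<o⇒n<o⇒m+n≤3*o∸3 {m} {n} {suc o} (s≤s m≤o) (s≤s n≤o) = begin
  m + n               ≤⟨ +-mono-≤ m≤o n≤o ⟩
  o + o               ≤⟨ +-monoʳ-≤ o (m≤m+n o (o + 0)) ⟩
  3 * o               ≡⟨ m+n∸m≡n 3 (3 * o) ⟨
  3 + 3 * o ∸ 3       ≡⟨ cong (_∸ 3) (*-suc 3 o) ⟨
  3 * suc o ∸ 3       ∎
  where open ≤-Reasoning

module DisjointFamily {ω n′ : ℕ} (ω-small : 3 * ω ∸ 3 < suc n′) (f : Fin (suc n′) → Chord (suc n′) ω)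
                      (disjoint : ∀ x y → x ≢ y → Disjoint (f x) (f y)) where

  n : ℕ
  n = suc n′

  iᶠ jᶠ : Fin n → ℕ
  iᶠ x = toℕ (i (f x))
  jᶠ x = j (f x)

  jᶠ+jᶠ<n : ∀ x y → jᶠ x + jᶠ y < n
  jᶠ+jᶠ<n x y = ≤-<-trans (m<o⇒n<o⇒m+n≤3*o∸3 (j<ω (f x)) (j<ω (f y))) ω-small

  jᶠ<n : ∀ x → jᶠ x < n
  jᶠ<n x = ≤-<-trans (m≤m+n (jᶠ x) (jᶠ x)) (jᶠ+jᶠ<n x x)

  Intersect⇒≡ : ∀ {x y} → Intersect (f x) (f y) → x ≡ y
  Intersect⇒≡ {x} {y} meet with x ≟ᶠ y
  ... | yes x≡y = x≡y
  ... | no x≢y  = ⊥-elim (disjoint x y x≢y meet)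

  x₀ : Fin n
  x₀ = argmax jᶠ zero (allFin n)

  jᶠ≤jᶠx₀ : ∀ y → jᶠ y ≤ jᶠ x₀
  jᶠ≤jᶠx₀ y = All.lookup (f[xs]≤f[argmax] {f = jᶠ} zero (allFin n)) (∈-allFin y)

  i₀ j₀ : ℕ
  i₀ = iᶠ x₀
  j₀ = jᶠ x₀

  s : Fin n → ℕ
  s x = liftAbove n i₀ (iᶠ x)

  i₀≤s : ∀ x → i₀ ≤ s x
  i₀≤s x = b≤liftAbove {r = iᶠ x} (toℕ<n (i (f x₀)))

  s<i₀+n : ∀ x → s x < i₀ + n
  s<i₀+n x = liftAbove<b+n {b = i₀} (toℕ<n (i (f x)))

  s%n : ∀ x → s x % n ≡ iᶠ x
  s%n x = liftAbove-% {b = i₀} (toℕ<n (i (f x)))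

  wrapping⇒Intersect : ∀ x → i₀ + n ≤ s x + jᶠ x → Intersect (f x) (f x₀)
  wrapping⇒Intersect x wraps =
    interleaved⇒Intersect {c = f x} {d = f x₀} {s = s x} {t = i₀ + n} (s%n x) [i₀+n]%n≡i₀
      (s<i₀+n x) wraps (+-mono-<-≤ (s<i₀+n x) (jᶠ≤jᶠx₀ x)) i₀+n+j₀<s+n
    where
    open ≤-Reasoning
    [i₀+n]%n≡i₀ : (i₀ + n) % n ≡ i₀
    [i₀+n]%n≡i₀ = trans ([m+n]%n≡m%n i₀ n) (m<n⇒m%n≡m (toℕ<n (i (f x₀))))
    i₀+j₀<s : i₀ + j₀ < s x
    i₀+j₀<s = +-cancelʳ-< (jᶠ x) (i₀ + j₀) (s x) (begin-strict
      i₀ + j₀ + jᶠ x   ≡⟨ +-assoc i₀ j₀ (jᶠ x) ⟩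
      i₀ + (j₀ + jᶠ x) <⟨ +-monoʳ-< i₀ (jᶠ+jᶠ<n x₀ x) ⟩
      i₀ + n           ≤⟨ wraps ⟩
      s x + jᶠ x       ∎)
    i₀+n+j₀<s+n : i₀ + n + j₀ < s x + n
    i₀+n+j₀<s+n = begin-strict
      i₀ + n + j₀      ≡⟨ +-assoc i₀ n j₀ ⟩
      i₀ + (n + j₀)    ≡⟨ cong (i₀ +_) (+-comm n j₀) ⟩
      i₀ + (j₀ + n)    ≡⟨ +-assoc i₀ j₀ n ⟨
      i₀ + j₀ + n      <⟨ +-monoˡ-< n i₀+j₀<s ⟩
      s x + n          ∎

  x₀-no-wrap : s x₀ + j₀ < i₀ + n
  x₀-no-wrap = subst (λ t → t + j₀ < i₀ + n) (sym (liftAbove-self n i₀)) (+-monoʳ-< i₀ (jᶠ<n x₀))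

  no-wrap : ∀ x → s x + jᶠ x < i₀ + n
  no-wrap x = ≰⇒> λ wraps →
    <⇒≱ x₀-no-wrap
      (subst (λ y → i₀ + n ≤ s y + jᶠ y) (Intersect⇒≡ (wrapping⇒Intersect x wraps)) wraps)

  window : Fin n → Interval
  window x = s x , s x + jᶠ x

  window-injective : ∀ {x y} → window x ≡ window y → x ≡ y
  window-injective {x} {y} eq = Intersect⇒≡ (coincident⇒Intersect {c = f x} {d = f y} i≡ j≡)
    where
    s≡ : s x ≡ s y
    s≡ = cong proj₁ eq
    j≡ : jᶠ x ≡ jᶠ y
    j≡ = +-cancelˡ-≡ (s x) (jᶠ x) (jᶠ y) (trans (cong proj₂ eq) (cong (_+ jᶠ y) (sym s≡)))
    i≡ : iᶠ x ≡ iᶠ y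
    i≡ = trans (sym (s%n x)) (trans (cong (_% n) s≡) (s%n y))

  crossing⇒Intersect : ∀ x y → Crosses (window x) (window y) → Intersect (f x) (f y)
  crossing⇒Intersect x y (s<t , t≤e , e<e′) =
    interleaved⇒Intersect {c = f x} {d = f y} {s = s x} {t = s y} (s%n x) (s%n y) s<t t≤e e<e′ e′<s+n
    where
    e′<s+n : s y + jᶠ y < s x + n
    e′<s+n = <-≤-trans (no-wrap y) (+-monoˡ-≤ n (i₀≤s x))

  window-noncrossing : ∀ x y → ¬ Crosses (window x) (window y)
  window-noncrossing x y cross =
    <-irrefl (cong s (Intersect⇒≡ (crossing⇒Intersect x y cross))) (proj₁ cross)

  window-within : ∀ x → Within i₀ (i₀ + n′) (window x)
  window-within x = i₀≤s x , m<m+n (s x) (1≤j (f x)) , s+j≤i₀+n′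
    where
    s+j≤i₀+n′ : s x + jᶠ x ≤ i₀ + n′
    s+j≤i₀+n′ = ≤-pred (subst (s x + jᶠ x <_) (+-suc i₀ n′) (no-wrap x))

  windows-laminar : LaminarIn i₀ (i₀ + n′) (tabulate window)
  windows-laminar = record
    { unique      = Unique.tabulate⁺ {f = window} window-injective
    ; within      = λ I∈ → let x , I≡x = ∈-tabulate⁻ {f = window} I∈ in
                      subst (Within i₀ (i₀ + n′)) (sym I≡x) (window-within x)
    ; noncrossing = λ I∈ J∈ → let x , I≡x = ∈-tabulate⁻ {f = window} I∈
                                  y , J≡y = ∈-tabulate⁻ {f = window} J∈ in
                      subst₂ (λ I J → ¬ Crosses I J) (sym I≡x) (sym J≡y) (window-noncrossing x y)
    }

  absurd : ⊥
  absurd = <-irrefl (+-comm n′ i₀) n+i₀≤i₀+n′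
    where
    n+i₀≤i₀+n′ : n + i₀ ≤ i₀ + n′
    n+i₀≤i₀+n′ = subst (λ k → k + i₀ ≤ i₀ + n′) (length-tabulate window)
                   (laminar-length (m≤m+n i₀ n′) windows-laminar)

lemma15 : (ω n : ℕ) → .{{_ : NonZero n}} → 1 ≤ ω → 3 * ω ∸ 3 < n →
    ¬ (∃ λ (f : Fin n → Chord n ω) → PairwiseDisjointFamily n f)
lemma15 ω zero _ ()
lemma15 ω (suc n′) _ ω-small (f , _ , disjoint) = DisjointFamily.absurd ω-small f disjoint
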